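{- Let $H$ be a connected graph that is edge-maximal with respect to a width-$t$ $r$-rooted tree decomposition $\mathcal{T}=(B_x:x\in V(T))$ of $H$, and let $L_0,\ldots,L_m$ be a BFS layering of $H$ with $L_0=B_r$. Then for any $i\in\{1,\ldots,m\}$ and any connected component $X$ of $H[\bigcup_{j=i}^m L_j]$, we have $|L_{i-1}\cap N_H(V(X))|\le t$.
   Context: A tree decomposition $(B_x:x\in V(T))$ of $H$ consists of bags $B_x\subseteq V(H)$ indexed by nodes of a tree $T$ such that for each vertex the nodes whose bags contain it induce a connected subtree, and each edge lies in some bag; its width is $\max_x|B_x|-1$; it is $r$-rooted if $T$ is rooted at node $r$. $H$ is edge-maximal with respect to it if every bag induces a clique. A BFS layering of a connected graph $H$ is a partition $(L_0,\ldots,L_m)$ of $V(H)$ such that for each $i\ge1$ and $v\in L_i$, $d_H(v,L_0)=i$. For $S\subseteq V(H)$, $N_H(S)$ is the set of vertices not in $S$ that have a neighbour in $S$. -}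

module Defs where

open import Level using (0ℓ)
open import Data.Nat using (ℕ; zero; suc; _≤_; _∸_)
open import Data.Fin using (Fin)
open import Data.Fin.Subset using (Subset; _∈_; _⊆_; ∣_∣)
open import Data.List using (List; []; _∷_; _++_; length)
open import Data.List.Relation.Unary.All using (All)
open import Data.List.Relation.Unary.Unique.Propositional using (Unique)
open import Data.List.Relation.Unary.Linked using (Linked)
open import Data.Product using (Σ; ∃; _×_)
open import Relation.Binary.PropositionalEquality using (_≡_; _≢_)
open import Relation.Binary.Construct.Closure.ReflexiveTransitive using (Star)
open import Relation.Nullary using (¬_)
open import Data.Unit using (⊤)

record Graph (n : ℕ) : Set₁ where
  field
    E      : Fin n → Fin n → Set
    sym    : ∀ {u v} → E u v → E v u
    irrefl : ∀ {u} → ¬ E u u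
open Graph public

InducedEdge : ∀ {n} → (Fin n → Fin n → Set) → (Fin n → Set) → Fin n → Fin n → Set
InducedEdge E P a b = P a × P b × E a b

ConnectedIn : ∀ {n} → (Fin n → Fin n → Set) → (Fin n → Set) → Set
ConnectedIn E P = ∀ u v → P u → P v → Star (InducedEdge E P) u v

Connected : ∀ {n} → Graph n → Set
Connected G = ConnectedIn (E G) (λ _ → ⊤)

IsCycle : ∀ {n} → Graph n → Fin n → List (Fin n) → Set
IsCycle G u xs = Unique (u ∷ xs) × (2 ≤ length xs) × Linked (E G) (u ∷ xs ++ u ∷ [])

IsTree : ∀ {k} → Graph k → Set
IsTree T = Connected T × (∀ u xs → ¬ IsCycle T u xs)

data Walk {n} (E : Fin n → Fin n → Set) : ℕ → Fin n → Fin n → Set where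
  here : ∀ {a} → Walk E 0 a a
  step : ∀ {a b c m} → E a b → Walk E m b c → Walk E (suc m) a c

Dist : ∀ {n} → Graph n → (Fin n → Set) → Fin n → ℕ → Set
Dist G S v i =
  (∃ λ u → S u × Walk (E G) i u v) × (∀ j u → S u → Walk (E G) j u v → i ≤ j)

IsTreeDecomposition : ∀ {n k} → Graph n → Graph k → (Fin k → Subset n) → Set
IsTreeDecomposition H T B =
  IsTree T ×
  (∀ v → (∃ λ x → v ∈ B x) × ConnectedIn (E T) (λ x → v ∈ B x)) ×
  (∀ u v → E H u v → ∃ λ x → u ∈ B x × v ∈ B x)

HasWidth : ∀ {n k} → (Fin k → Subset n) → ℕ → Set
HasWidth B t = (∀ x → ∣ B x ∣ ≤ suc t) × (∃ λ x → ∣ B x ∣ ≡ suc t)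

-- H is edge-maximal w.r.t. the decomposition: every bag induces a clique.
EdgeMaximal : ∀ {n k} → Graph n → (Fin k → Subset n) → Set
EdgeMaximal H B = ∀ x u v → u ∈ B x → v ∈ B x → u ≢ v → E H u v

-- BFS layering (L_0,...,L_m) given by a layer function ℓ (v ∈ L_j iff ℓ v ≡ j):
-- a partition into m+1 nonempty parts with d_H(v, L_0) = i for v ∈ L_i, i ≥ 1.
IsBFSLayering : ∀ {n} → Graph n → ℕ → (Fin n → ℕ) → Set
IsBFSLayering H m ℓ =
  (∀ v → ℓ v ≤ m) ×
  (∀ j → j ≤ m → ∃ λ v → ℓ v ≡ j) ×
  (∀ v → 1 ≤ ℓ v → Dist H (λ u → ℓ u ≡ 0) v (ℓ v))

IsComponent : ∀ {n} → Graph n → (Fin n → Set) → Subset n → Set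
IsComponent {n} H U X =
  (∃ λ v → v ∈ X) ×
  (∀ v → v ∈ X → U v) ×
  ConnectedIn (E H) (_∈ X) ×
  (∀ (Y : Subset n) → X ⊆ Y → (∀ v → v ∈ Y → U v) → ConnectedIn (E H) (_∈ Y) → Y ⊆ X)

Nbhd : ∀ {n} → Graph n → Subset n → Fin n → Set
Nbhd H S v = ¬ (v ∈ S) × ∃ λ u → u ∈ S × E H u v

-- |P| ≤ t for a predicate P on a finite set: every duplicate-free list of elements of P has length ≤ t.
CardAtMost : ∀ {n} → (Fin n → Set) → ℕ → Set
CardAtMost P t = ∀ (xs : List (Fin _)) → Unique xs → All P xs → length xs ≤ t

module Submission where

-- We show that ONE bag B_g contains a vertex
-- of X and all of L_{i-1} ∩ N_H(X); as |B_g| ≤ t + 1 and that vertex of X is not in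
-- N_H(X), counting gives |L_{i-1} ∩ N_H(X)| ≤ t.
--
-- The tree nodes whose bags meet X form a connected set A missing the root r (B_r = L_0).
-- Its entry node g, where the path from r first enters A, lies on every walk of T from r
-- into A, since tree edges are bridges.  For v ∈ L_{i-1} ∩ N_H(X), a BFS geodesic from L_0
-- to v lifts to a walk of T from r to a bag shared by v and its neighbour in X, through
-- bags containing v or a vertex of a layer < i - 1.  So B_g holds v or such a vertex; the
-- latter is impossible, as B_g is a clique that also holds a vertex of X (layer ≥ i).

open import Defs
open import Data.Nat using (ℕ; suc; _≤_; _<_; _∸_; _+_; z≤n; s≤s) renaming (_≟_ to _≟ℕ_)
open import Data.Nat.Properties
  using (≤-refl; ≤-trans; ≤-pred; n≤1+n; n≮n; n≢0⇒n>0; m≤m+n; +-monoˡ-≤; +-suc; module ≤-Reasoning)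
open import Data.Fin using (Fin; _≟_)
open import Data.Fin.Properties using (any?)
open import Data.Fin.Subset using (Subset; _∈_; _-_; ∣_∣)
open import Data.Fin.Subset.Properties using (_∈?_; x∈p∧x≢y⇒x∈p-y; x∈p⇒∣p-x∣<∣p∣)
open import Data.Product using (∃; ∃₂; _×_; _,_; proj₁; proj₂)
open import Data.Sum using (_⊎_; inj₁; inj₂)
open import Data.Empty using (⊥; ⊥-elim)
open import Data.Unit using (tt)
open import Data.List using (List; []; _∷_; _++_; length)
open import Data.List.Relation.Unary.All as All using (All; []; _∷_)
open import Data.List.Relation.Unary.All.Properties using (¬Any⇒All¬)
open import Data.List.Relation.Unary.AllPairs using ([]; _∷_)
open import Data.List.Relation.Unary.Any using (here; there) renaming (any? to anyₗ?)
open import Data.List.Relation.Unary.Unique.Propositional using (Unique)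
open import Data.List.Relation.Unary.Linked using (Linked; [-]; _∷_)
open import Data.List.Membership.Propositional using () renaming (_∈_ to _∈ₗ_; _∉_ to _∉ₗ_)
open import Relation.Binary.PropositionalEquality using (_≡_; _≢_; refl; subst) renaming (sym to ≡-sym)
open import Relation.Binary.Construct.Closure.ReflexiveTransitive using (Star; ε; _◅_; _◅◅_; map; reverse)
open import Relation.Nullary using (¬_; yes; no)
open import Relation.Nullary.Decidable using (_×-dec_)
open import Relation.Unary using (Decidable)

private
  variable
    n k : ℕ
    a b c g h : Fin k
    R : Fin k → Fin k → Set
    P Q : Fin k → Set

distinct≤card : (p : Subset n) (xs : List (Fin n)) → Unique xs → All (_∈ p) xs → length xs ≤ ∣ p ∣
distinct≤card p []       _            _            = z≤n
distinct≤card p (x ∷ xs) (x∉xs ∷ uniq) (x∈p ∷ xs⊆p) =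
  ≤-trans (s≤s (distinct≤card (p - x) xs uniq xs⊆p-x)) (x∈p⇒∣p-x∣<∣p∣ x∈p)
  where
    xs⊆p-x : All (_∈ p - x) xs
    xs⊆p-x = All.zipWith (λ (x≢y , y∈p) → x∈p∧x≢y⇒x∈p-y y∈p (λ y≡x → x≢y (≡-sym y≡x))) (x∉xs , xs⊆p)

InducedWalk : (Fin k → Fin k → Set) → (Fin k → Set) → Fin k → Fin k → Set
InducedWalk R P = Star (InducedEdge R P)

weaken : (∀ {x} → P x → Q x) → InducedWalk R P a b → InducedWalk R Q a b
weaken f = map (λ (pa , pb , e) → f pa , f pb , e)

reverseWalk : (∀ {x y} → R x y → R y x) → InducedWalk R P a b → InducedWalk R P b a
reverseWalk flip = reverse (λ (pa , pb , e) → pb , pa , flip e)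

visitOrAvoid : (g : Fin k) → InducedWalk R P a b → P g ⊎ InducedWalk R (λ x → P x × x ≢ g) a b
visitOrAvoid g ε = inj₂ ε
visitOrAvoid {a = a} g (_◅_ {j = c} (pa , pc , e) w) with a ≟ g | c ≟ g | visitOrAvoid g w
... | yes refl | _        | _       = inj₁ pa
... | _        | yes refl | _       = inj₁ pc
... | no _     | no _     | inj₁ pg = inj₁ pg
... | no a≢g   | no c≢g   | inj₂ w′ = inj₂ (((pa , a≢g) , (pc , c≢g) , e) ◅ w′)

firstEntry : {A : Fin k → Set} → Decidable A → Star R a b → ¬ A a → A b
           → ∃₂ λ h g → InducedWalk R (λ x → ¬ A x) a h × ¬ A h × R h g × A g
firstEntry A? ε ¬Aa Ab = ⊥-elim (¬Aa Ab)
firstEntry {a = a} A? (_◅_ {j = c} e w) ¬Aa Ab with A? c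
... | yes Ac = a , c , ε , ¬Aa , e , Ac
... | no ¬Ac with firstEntry A? w ¬Ac Ab
...   | h , g , before , ¬Ah , hg , Ag = h , g , (¬Aa , ¬Ac , e) ◅ before , ¬Ah , hg , Ag

data SimplePath (R : Fin k → Fin k → Set) : Fin k → Fin k → List (Fin k) → Set where
  stop : SimplePath R a a []
  step : ∀ {ns} → R a c → SimplePath R c b ns → a ∉ₗ c ∷ ns → SimplePath R a b (c ∷ ns)

suffixFrom : ∀ {ns} → SimplePath R c b ns → a ∈ₗ c ∷ ns → ∃ (SimplePath R a b)
suffixFrom p                (here refl) = _ , p
suffixFrom (step _ p _)     (there a∈)  = suffixFrom p a∈

shortcut : Star R a b → ∃ (SimplePath R a b)
shortcut ε = [] , stop
shortcut {a = a} (_◅_ {j = c} e w) with shortcut w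
... | ns , p with anyₗ? (a ≟_) (c ∷ ns)
...   | yes a∈ = suffixFrom p a∈
...   | no a∉  = c ∷ ns , step e p a∉

simplePath-unique : ∀ {ns} → SimplePath R a b ns → Unique (a ∷ ns)
simplePath-unique stop           = [] ∷ []
simplePath-unique (step _ p a∉)  = ¬Any⇒All¬ _ a∉ ∷ simplePath-unique p

simplePath-linked : {S : Fin k → Fin k → Set} → (∀ {x y} → R x y → S x y)
                  → ∀ {ns} → SimplePath R a b ns → S b c → Linked S (a ∷ ns ++ c ∷ [])
simplePath-linked R⊆S stop          e′ = e′ ∷ [-]
simplePath-linked R⊆S (step e p _)  e′ = R⊆S e ∷ simplePath-linked R⊆S p e′

NotEdge : Fin k → Fin k → Fin k → Fin k → Set
NotEdge h g x y = ¬ (x ≡ h × y ≡ g) × ¬ (x ≡ g × y ≡ h)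

EdgeOtherThan : (Fin k → Fin k → Set) → Fin k → Fin k → Fin k → Fin k → Set
EdgeOtherThan R h g x y = R x y × NotEdge h g x y

edge-is-bridge : (T : Graph k) → (∀ u xs → ¬ IsCycle T u xs) → E T h g
               → ¬ Star (EdgeOtherThan (E T) h g) h g
edge-is-bridge T acyclic hg w with shortcut w
... | [] , stop = irrefl T hg
... | _ ∷ [] , step (_ , notHG) stop _ = proj₁ notHG (refl , refl)
... | _ ∷ _ ∷ _ , p@(step _ (step _ _ _) _) =
  acyclic _ _ (simplePath-unique p , s≤s (s≤s z≤n) , simplePath-linked proj₁ p (sym T hg))

≢ᵍ⇒NotEdge : {h g x y : Fin k} → x ≢ g → y ≢ g → NotEdge h g x y
≢ᵍ⇒NotEdge x≢g y≢g = (λ (_ , y≡g) → y≢g y≡g) , (λ (x≡g , _) → x≢g x≡g)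

≢ʰ⇒NotEdge : {h g x y : Fin k} → x ≢ h → y ≢ h → NotEdge h g x y
≢ʰ⇒NotEdge x≢h y≢h = (λ (x≡h , _) → x≢h x≡h) , (λ (_ , y≡h) → y≢h y≡h)

missesEdge : (∀ {x y} → P x → P y → NotEdge h g x y)
           → InducedWalk R P a b → Star (EdgeOtherThan R h g) a b
missesEdge notHG = map (λ (px , py , e) → e , notHG px py)

-- In a tree, a nonempty connected set A of nodes missing the root r has an entry node
-- g ∈ A: every walk from r into A passes through g.  (g is where the path from r first
-- enters A; a walk into A avoiding g would give a detour around the bridge h g.)
entryNode : (T : Graph k) (r : Fin k) {A : Fin k → Set} → IsTree T → Decidable A → ¬ A r → ∃ A
          → ConnectedIn (E T) A
          → ∃ λ g → A g × (∀ {P : Fin k → Set} {a} → A a → InducedWalk (E T) P r a → P g)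
entryNode {k} T r {A} (connected , acyclic) A? ¬Ar (x₀ , Ax₀) A-connected
  with firstEntry A? (map (λ (_ , _ , e) → e) (connected r x₀ tt tt)) ¬Ar Ax₀
... | h , g , before , ¬Ah , hg , Ag = g , Ag , throughEntry
  where
    throughEntry : ∀ {P : Fin k → Set} {a} → A a → InducedWalk (E T) P r a → P g
    throughEntry {a = a} Aa w with visitOrAvoid g w
    ... | inj₁ Pg = Pg
    ... | inj₂ w′ = ⊥-elim (edge-is-bridge T acyclic hg (h→r ◅◅ r→a ◅◅ a→g))
      where
        ¬A⇒≢g : ∀ {x} → ¬ A x → x ≢ g
        ¬A⇒≢g ¬Ax x≡g = ¬Ax (subst A (≡-sym x≡g) Ag)
        A⇒≢h : ∀ {x} → A x → x ≢ h
        A⇒≢h Ax x≡h = ¬Ah (subst A x≡h Ax)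
        h→r : Star (EdgeOtherThan (E T) h g) h r
        h→r = missesEdge (λ ¬Ax ¬Ay → ≢ᵍ⇒NotEdge (¬A⇒≢g ¬Ax) (¬A⇒≢g ¬Ay)) (reverseWalk (sym T) before)
        r→a : Star (EdgeOtherThan (E T) h g) r a
        r→a = missesEdge (λ (_ , x≢g) (_ , y≢g) → ≢ᵍ⇒NotEdge x≢g y≢g) w′
        a→g : Star (EdgeOtherThan (E T) h g) a g
        a→g = missesEdge (λ Ax Ay → ≢ʰ⇒NotEdge (A⇒≢h Ax) (A⇒≢h Ay)) (A-connected a g Aa Ag)

IsLayerDistance : Graph n → (Fin n → ℕ) → Set
IsLayerDistance H ℓ = ∀ v → 1 ≤ ℓ v → Dist H (λ u → ℓ u ≡ 0) v (ℓ v)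

module Geodesics (H : Graph n) (ℓ : Fin n → ℕ) (isDistance : IsLayerDistance H ℓ) where

  walk-snoc : ∀ {j} {a b c : Fin n} → Walk (E H) j a b → E H b c → Walk (E H) (suc j) a c
  walk-snoc here       e′ = step e′ here
  walk-snoc (step e w) e′ = step e (walk-snoc w e′)

  geodesic : ∀ v → ∃ λ u → ℓ u ≡ 0 × Walk (E H) (ℓ v) u v
  geodesic v with ℓ v ≟ℕ 0
  ... | yes ℓv≡0 = v , ℓv≡0 , subst (λ j → Walk (E H) j v v) (≡-sym ℓv≡0) here
  ... | no ℓv≢0  = proj₁ (isDistance v (n≢0⇒n>0 ℓv≢0))

  layer-step : ∀ {x y} → E H x y → ℓ y ≤ suc (ℓ x)
  layer-step {x} {y} e with ℓ y ≟ℕ 0 | geodesic x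
  ... | yes ℓy≡0 | _             = subst (_≤ suc (ℓ x)) (≡-sym ℓy≡0) z≤n
  ... | no ℓy≢0  | u , ℓu≡0 , w = proj₂ (isDistance y (n≢0⇒n>0 ℓy≢0)) _ u ℓu≡0 (walk-snoc w e)

  Below : Fin n → Fin n → Set
  Below v w = w ≡ v ⊎ ℓ w < ℓ v

  geodesic-below : ∀ {j a v} → Walk (E H) j a v → ℓ a + j ≤ ℓ v
                 → Below v a × InducedWalk (E H) (Below v) a v
  geodesic-below here _ = inj₁ refl , ε
  geodesic-below {a = a} {v} (step {b = c} {m = j} e w) bound =
    inj₂ ℓa<ℓv , (inj₂ ℓa<ℓv , proj₁ rest , e) ◅ proj₂ rest
    where
      bound′ : suc (ℓ a + j) ≤ ℓ v
      bound′ = subst (_≤ ℓ v) (+-suc (ℓ a) j) bound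
      ℓa<ℓv : ℓ a < ℓ v
      ℓa<ℓv = ≤-trans (s≤s (m≤m+n (ℓ a) j)) bound′
      rest : Below v c × InducedWalk (E H) (Below v) c v
      rest = geodesic-below w (≤-trans (+-monoˡ-≤ j (layer-step e)) bound′)

Meets : (Fin k → Subset n) → (Fin n → Set) → Fin k → Set
Meets B S x = ∃ λ w → S w × w ∈ B x

-- A walk in H[S] lifts to a walk in T, between any bags of its ends, through bags
-- meeting S: consecutive vertices share a bag, and the bags of each vertex are connected.
module Lifting (H : Graph n) (T : Graph k) (B : Fin k → Subset n) (td : IsTreeDecomposition H T B) where

  withinBags : (S : Fin n → Set) {u : Fin n} {x y : Fin k}
             → S u → u ∈ B x → u ∈ B y → InducedWalk (E T) (Meets B S) x y
  withinBags S {u} Su u∈x u∈y = weaken (λ u∈z → u , Su , u∈z) (proj₂ (proj₁ (proj₂ td) u) _ _ u∈x u∈y)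

  liftWalk : (S : Fin n → Set) {u u′ : Fin n} {x y : Fin k}
           → S u → InducedWalk (E H) S u u′ → u ∈ B x → u′ ∈ B y → InducedWalk (E T) (Meets B S) x y
  liftWalk S Su ε u∈x u∈y = withinBags S Su u∈x u∈y
  liftWalk S Su ((_ , Su₁ , e) ◅ w) u∈x u₁∈y with proj₂ (proj₂ td) _ _ e
  ... | z , u∈z , u₁∈z = withinBags S Su u∈x u∈z ◅◅ liftWalk S Su₁ w u₁∈z u₁∈y

no-layer-between : ∀ {i j} → 1 ≤ i → i ≤ j → j ≤ i ∸ 1 → ⊥
no-layer-between {suc i} _ i<j j≤i = n≮n i (≤-trans i<j j≤i)

module BoundaryBag {n k} (H : Graph n) (T : Graph k) (B : Fin k → Subset n) (r : Fin k) (ℓ : Fin n → ℕ)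
    (td : IsTreeDecomposition H T B) (em : EdgeMaximal H B) (isDistance : IsLayerDistance H ℓ)
    (rootBag : ∀ v → (ℓ v ≡ 0 → v ∈ B r) × (v ∈ B r → ℓ v ≡ 0))
    (i : ℕ) (1≤i : 1 ≤ i) (X : Subset n) (comp : IsComponent H (λ v → i ≤ ℓ v) X) where

  open Geodesics H ℓ isDistance
  open Lifting H T B td

  -- Vertices of a common bag are equal or adjacent (edge-maximality), so at most one
  -- layer apart.
  sameBag-layers : ∀ {x u w} → u ∈ B x → w ∈ B x → ℓ u ≤ suc (ℓ w)
  sameBag-layers {x} {u} {w} u∈x w∈x with w ≟ u
  ... | yes refl = n≤1+n (ℓ u)
  ... | no w≢u   = layer-step (em x w u w∈x u∈x w≢u)

  X-deep : ∀ {u} → u ∈ X → i ≤ ℓ u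
  X-deep = proj₁ (proj₂ comp) _

  MeetsX : Fin k → Set
  MeetsX = Meets B (_∈ X)

  meetsX? : Decidable MeetsX
  meetsX? x = any? (λ u → (u ∈? X) ×-dec (u ∈? B x))

  root-misses-X : ¬ MeetsX r
  root-misses-X (u , u∈X , u∈r) =
    no-layer-between 1≤i (X-deep u∈X) (subst (_≤ i ∸ 1) (≡-sym (proj₂ (rootBag u) u∈r)) z≤n)

  meetsX-nonempty : ∃ MeetsX
  meetsX-nonempty with proj₁ comp
  ... | v₀ , v₀∈X with proj₁ (proj₁ (proj₂ td) v₀)
  ...   | x₀ , v₀∈x₀ = x₀ , v₀ , v₀∈X , v₀∈x₀

  meetsX-connected : ConnectedIn (E T) MeetsX
  meetsX-connected x y (u , u∈X , u∈x) (u′ , u′∈X , u′∈y) =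
    liftWalk (_∈ X) u∈X (proj₁ (proj₂ (proj₂ comp)) u u′ u∈X u′∈X) u∈x u′∈y

  geodesic-in-T : ∀ v {z} → v ∈ B z → InducedWalk (E T) (Meets B (Below v)) r z
  geodesic-in-T v v∈z with geodesic v
  ... | u₀ , ℓu₀≡0 , w with geodesic-below w (subst (λ j → j + ℓ v ≤ ℓ v) (≡-sym ℓu₀≡0) ≤-refl)
  ...   | u₀-below , w′ = liftWalk (Below v) u₀-below w′ (proj₁ (rootBag u₀) ℓu₀≡0) v∈z

  bag-of-X-above : ∀ {x w} → MeetsX x → w ∈ B x → ¬ ℓ w < i ∸ 1
  bag-of-X-above (u , u∈X , u∈x) w∈x ℓw<i-1 =
    no-layer-between 1≤i (X-deep u∈X) (≤-trans (sameBag-layers u∈x w∈x) ℓw<i-1)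

  -- Every vertex v of L_{i-1} ∩ N_H(X) lies in the bag of the entry node g of MeetsX: the
  -- lifted geodesic ends at a bag shared by v and its neighbour in X, so it passes g.
  boundaryBag : ∃ λ g → MeetsX g × (∀ v → ℓ v ≡ i ∸ 1 × Nbhd H X v → v ∈ B g)
  boundaryBag with entryNode T r (proj₁ td) meetsX? root-misses-X meetsX-nonempty meetsX-connected
  ... | g , meetsX-g , throughEntry = g , meetsX-g , inBag
    where
      inBag : ∀ v → ℓ v ≡ i ∸ 1 × Nbhd H X v → v ∈ B g
      inBag v (ℓv≡i-1 , _ , y , y∈X , yv) with proj₂ (proj₂ td) y v yv
      ... | z , y∈z , v∈z with throughEntry (y , y∈X , y∈z) (geodesic-in-T v v∈z)
      ...   | _  , inj₁ refl    , v∈g  = v∈g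
      ...   | w₀ , inj₂ ℓw₀<ℓv , w₀∈g =
        ⊥-elim (bag-of-X-above meetsX-g w₀∈g (subst (ℓ w₀ <_) ℓv≡i-1 ℓw₀<ℓv))

-- The bag B_g holds a vertex u ∈ X and all the
-- listed boundary vertices, which differ from u as they lie outside X; so the list has
-- at most |B_g| - 1 ≤ t entries.
mainTheorem10 : ∀ {n k} (H : Graph n) (T : Graph k) (B : Fin k → Subset n) (r : Fin k) (t m : ℕ) (ℓ : Fin n → ℕ)
    → Connected H
    → IsTreeDecomposition H T B
    → HasWidth B t
    → EdgeMaximal H B
    → IsBFSLayering H m ℓ
    → (∀ v → (ℓ v ≡ 0 → v ∈ B r) × (v ∈ B r → ℓ v ≡ 0))
    → ∀ (i : ℕ) → 1 ≤ i → i ≤ m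
    → ∀ (X : Subset n) → IsComponent H (λ v → i ≤ ℓ v) X
    → CardAtMost (λ v → ℓ v ≡ i ∸ 1 × Nbhd H X v) t
mainTheorem10 H T B r t m ℓ _ td (bagSize , _) em (_ , _ , isDistance) rootBag i 1≤i _ X comp xs distinct boundary
  with BoundaryBag.boundaryBag H T B r ℓ td em isDistance rootBag i 1≤i X comp
... | g , (u , u∈X , u∈g) , boundary⊆g = ≤-pred (begin
  length (u ∷ xs)  ≤⟨ distinct≤card (B g) (u ∷ xs) (All.map u≢ boundary ∷ distinct)
                                     (u∈g ∷ All.map (boundary⊆g _) boundary) ⟩
  ∣ B g ∣          ≤⟨ bagSize g ⟩
  suc t            ∎)
  where
    open ≤-Reasoning
    u≢ : ∀ {v} → ℓ v ≡ i ∸ 1 × Nbhd H X v → u ≢ v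
    u≢ (_ , v∉X , _) u≡v = v∉X (subst (_∈ X) u≡v u∈X)
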